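{- Let $m \in \mathbb{Z}^{+}$ and let $p = mk+1$ be a prime with $k$ even, and let $g$ be a primitive root modulo $p$. For $i \in \{0,1,\ldots,m-1\}$ define \[ X_i = \{ g^{i}, g^{m+i}, g^{2m+i}, \ldots, g^{(k-1)m+i} \} \subseteq \mathbb{Z}/p\mathbb{Z}. \] Suppose $(X_0 - 1) \cap X_0 = \emptyset$, and that for all $i,j \in \{0,1,\ldots,m-1\}$ not both zero we have $(X_0 - g^{j}) \cap X_i \neq \emptyset$. Then the sets $X_0,\ldots,X_{m-1}$ form a Ramsey algebra, i.e., they satisfy: (i) $-X_i = X_i$ for all $i$; (ii) $X_i + X_i = (\mathbb{Z}/p\mathbb{Z}) \setminus X_i$ for all $i$; (iii) $X_i + X_j = (\mathbb{Z}/p\mathbb{Z}) \setminus \{0\}$ for all $i \neq j$.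
   Context: For $A, B \subseteq \mathbb{Z}/p\mathbb{Z}$ and $c \in \mathbb{Z}/p\mathbb{Z}$, $A + B = \{a+b : a \in A, b \in B\}$, $-A = \{ -a : a \in A\}$, and $A - c = \{a - c : a \in A\}$. The $X_i$ are the cosets of the multiplicative subgroup of $(\mathbb{Z}/p\mathbb{Z})^\times$ of index $m$. Saying the $X_i$ "form a Ramsey algebra" means conditions (i)–(iii) hold; then the relations $A_i = \{(x,y) : x - y \in X_i\}$ on $\mathbb{Z}/p\mathbb{Z}$ together with the identity relation form an $m$-color Ramsey algebra. -}

module Defs where

open import Data.Nat using (ℕ; zero; suc; _+_; _*_; _∸_; _^_; _<_; NonZero)
open import Data.Nat.DivMod using (_mod_)
open import Data.Fin using (Fin; toℕ)
open import Data.Product using (∃-syntax; _×_)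
open import Relation.Binary.PropositionalEquality using (_≡_)
open import Relation.Nullary using (¬_)

-- ℤ/pℤ is modelled as Fin p (canonical residues 0,…,p-1), p nonzero.
module ZMod (p : ℕ) .{{_ : NonZero p}} where

  ZP : Set
  ZP = Fin p

  [_] : ℕ → ZP
  [ n ] = n mod p

  _⊕_ : ZP → ZP → ZP
  a ⊕ b = [ toℕ a + toℕ b ]

  ⊖_ : ZP → ZP
  ⊖ a = [ p ∸ toℕ a ]

  _⊝_ : ZP → ZP → ZP
  a ⊝ c = a ⊕ (⊖ c)

  pow : ℕ → ℕ → ZP
  pow g e = [ g ^ e ]

  IsPrimitiveRoot : ℕ → Set
  IsPrimitiveRoot g =
    ¬ ([ g ] ≡ [ 0 ]) ×
    (pow g (p ∸ 1) ≡ [ 1 ]) ×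
    (∀ e → 0 < e → e < p ∸ 1 → ¬ (pow g e ≡ [ 1 ]))

  Subset : Set₁
  Subset = ZP → Set

  X : (g m k i : ℕ) → Subset
  X g m k i x = ∃[ t ] (t < k × x ≡ pow g (t * m + i))

  neg : Subset → Subset
  neg A x = ∃[ a ] (A a × x ≡ ⊖ a)

  shift : Subset → ZP → Subset
  shift A c x = ∃[ a ] (A a × x ≡ a ⊝ c)

  sumset : Subset → Subset → Subset
  sumset A B x = ∃[ a ] ∃[ b ] (A a × B b × x ≡ a ⊕ b)

  _≐_ : Subset → Subset → Set
  A ≐ B = ∀ x → (A x → B x) × (B x → A x)

  Disjoint : Subset → Subset → Set
  Disjoint A B = ∀ x → ¬ (A x × B x)

  Meets : Subset → Subset → Set
  Meets A B = ∃[ x ] (A x × B x)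

  RamseyAlgebra : (m : ℕ) → (ℕ → Subset) → Set
  RamseyAlgebra m Y =
    (∀ i → i < m → neg (Y i) ≐ Y i) ×
    (∀ i → i < m → sumset (Y i) (Y i) ≐ (λ x → ¬ Y i x)) ×
    (∀ i j → i < m → j < m → ¬ (i ≡ j) →
       sumset (Y i) (Y j) ≐ (λ x → ¬ (x ≡ [ 0 ])))

-- The Xᵢ are the cosets gⁱH of H = X₀, the subgroup of index m in (ℤ/pℤ)ˣ, so membership in Xᵢ is
-- decided by the exponent of g modulo m, and multiplying by an element of X_c shifts the index by c.
-- (i): k is even, so -1 = g^(mk/2) ∈ H.
-- Sum-freeness: a + b = x in Xᵢ, divided by b, gives v = u + 1 with u, v ∈ X₀, contradicting
-- (X₀ - 1) ∩ X₀ = ∅; and a + b = 0 puts a = -b in the coset of b.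
-- Covering: for x ∈ X_e the second hypothesis gives h ∈ X₀ with z = h - g^(j-i) ∈ X_(e-i). Then
-- x = z w with w ∈ Xᵢ, so x = h w + (-g^(j-i) w) ∈ Xᵢ + Xⱼ; for j = i this needs e ≢ i, i.e. x ∉ Xᵢ.

module Submission where

open import Algebra.Bundles using (CommutativeRing)
open import Algebra.Structures using (IsCommutativeRing)
open import Data.Fin using (Fin; toℕ; zero; suc; punchOut)
import Data.Fin.Properties as Fin
open import Data.Nat
  using (ℕ; zero; suc; _+_; _*_; _∸_; _^_; _<_; _≤_; _%_; _/_; pred; s<s⁻¹;
         NonZero; >-nonZero; >-nonZero⁻¹; ≢-nonZero⁻¹; nonTrivial⇒n>1; nonTrivial⇒≢1)
import Data.Nat.Properties as ℕ
open import Data.Nat.DivMod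
open import Data.Nat.Divisibility
  using (_∣_; divides; m%n≡0⇒n∣m; n∣m⇒m%n≡0; ∣1⇒≡1; n∣m*n; ∣n⇒∣m*n)
open import Data.Nat.Primality using (Prime; euclidsLemma; prime⇒nonZero; prime⇒nonTrivial)
open import Data.Nat.Solver using (module +-*-Solver)
open import Data.Product using (_×_; _,_; ∃-syntax; proj₁; proj₂)
open import Data.Sum using (_⊎_; inj₁; inj₂)
import Data.Sum as Sum
open import Function using (_∘_)
open import Level using (0ℓ)
open import Relation.Binary.PropositionalEquality
  using (_≡_; _≢_; refl; sym; trans; cong; cong₂; subst; subst₂; isEquivalence; module ≡-Reasoning)
open import Relation.Nullary using (¬_; yes; no; contradiction)

open import Algebra.Properties.CommutativeSemigroup ℕ.+-commutativeSemigroup using (x∙yz≈y∙xz; xy∙z≈y∙xz)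

open import Defs

module ModularArithmetic (p : ℕ) .{{_ : NonZero p}} where
  open ZMod p

  infix 30 _⊗_
  _⊗_ : ZP → ZP → ZP
  a ⊗ b = [ toℕ a * toℕ b ]

  toℕ-[] : ∀ a → toℕ [ a ] ≡ a % p
  toℕ-[] a = Fin.toℕ-fromℕ< (m%n<n a p)

  []-toℕ : ∀ x → [ toℕ x ] ≡ x
  []-toℕ x = Fin.toℕ-injective (trans (toℕ-[] (toℕ x)) (m<n⇒m%n≡m (Fin.toℕ<n x)))

  0%p≡0 : 0 % p ≡ 0
  0%p≡0 = m<n⇒m%n≡m (>-nonZero⁻¹ p)

  %≡⇒[]≡ : ∀ {a b} → a % p ≡ b % p → [ a ] ≡ [ b ]
  %≡⇒[]≡ {a} {b} eq = Fin.toℕ-injective (trans (toℕ-[] a) (trans eq (sym (toℕ-[] b))))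

  []-elim : (P : ZP → Set) → (∀ a → P [ a ]) → ∀ x → P x
  []-elim P P[] x = subst P ([]-toℕ x) (P[] (toℕ x))

  []-homo-+ : ∀ a b → [ a ] ⊕ [ b ] ≡ [ a + b ]
  []-homo-+ a b = %≡⇒[]≡ (begin
    (toℕ [ a ] + toℕ [ b ]) % p  ≡⟨ cong₂ (λ u v → (u + v) % p) (toℕ-[] a) (toℕ-[] b) ⟩
    (a % p + b % p) % p          ≡⟨ %-distribˡ-+ a b p ⟨
    (a + b) % p                  ∎)
    where open ≡-Reasoning

  []-homo-* : ∀ a b → [ a ] ⊗ [ b ] ≡ [ a * b ]
  []-homo-* a b = %≡⇒[]≡ (begin
    (toℕ [ a ] * toℕ [ b ]) % p  ≡⟨ cong₂ (λ u v → (u * v) % p) (toℕ-[] a) (toℕ-[] b) ⟩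
    (a % p * (b % p)) % p        ≡⟨ %-distribˡ-* a b p ⟨
    (a * b) % p                  ∎)
    where open ≡-Reasoning

  ⊕-comm : ∀ x y → x ⊕ y ≡ y ⊕ x
  ⊕-comm x y = cong [_] (ℕ.+-comm (toℕ x) (toℕ y))

  ⊗-comm : ∀ x y → x ⊗ y ≡ y ⊗ x
  ⊗-comm x y = cong [_] (ℕ.*-comm (toℕ x) (toℕ y))

  ⊕-assoc : ∀ x y z → (x ⊕ y) ⊕ z ≡ x ⊕ (y ⊕ z)
  ⊕-assoc = []-elim _ λ a → []-elim _ λ b → []-elim _ λ c → begin
    ([ a ] ⊕ [ b ]) ⊕ [ c ]  ≡⟨ cong (_⊕ [ c ]) ([]-homo-+ a b) ⟩
    [ a + b ] ⊕ [ c ]        ≡⟨ []-homo-+ (a + b) c ⟩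
    [ a + b + c ]            ≡⟨ cong [_] (ℕ.+-assoc a b c) ⟩
    [ a + (b + c) ]          ≡⟨ []-homo-+ a (b + c) ⟨
    [ a ] ⊕ [ b + c ]        ≡⟨ cong ([ a ] ⊕_) ([]-homo-+ b c) ⟨
    [ a ] ⊕ ([ b ] ⊕ [ c ])  ∎
    where open ≡-Reasoning

  ⊗-assoc : ∀ x y z → (x ⊗ y) ⊗ z ≡ x ⊗ (y ⊗ z)
  ⊗-assoc = []-elim _ λ a → []-elim _ λ b → []-elim _ λ c → begin
    ([ a ] ⊗ [ b ]) ⊗ [ c ]  ≡⟨ cong (_⊗ [ c ]) ([]-homo-* a b) ⟩
    [ a * b ] ⊗ [ c ]        ≡⟨ []-homo-* (a * b) c ⟩
    [ a * b * c ]            ≡⟨ cong [_] (ℕ.*-assoc a b c) ⟩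
    [ a * (b * c) ]          ≡⟨ []-homo-* a (b * c) ⟨
    [ a ] ⊗ [ b * c ]        ≡⟨ cong ([ a ] ⊗_) ([]-homo-* b c) ⟨
    [ a ] ⊗ ([ b ] ⊗ [ c ])  ∎
    where open ≡-Reasoning

  ⊗-distribˡ-⊕ : ∀ x y z → x ⊗ (y ⊕ z) ≡ (x ⊗ y) ⊕ (x ⊗ z)
  ⊗-distribˡ-⊕ = []-elim _ λ a → []-elim _ λ b → []-elim _ λ c → begin
    [ a ] ⊗ ([ b ] ⊕ [ c ])              ≡⟨ cong ([ a ] ⊗_) ([]-homo-+ b c) ⟩
    [ a ] ⊗ [ b + c ]                    ≡⟨ []-homo-* a (b + c) ⟩
    [ a * (b + c) ]                      ≡⟨ cong [_] (ℕ.*-distribˡ-+ a b c) ⟩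
    [ a * b + a * c ]                    ≡⟨ []-homo-+ (a * b) (a * c) ⟨
    [ a * b ] ⊕ [ a * c ]                ≡⟨ cong₂ _⊕_ ([]-homo-* a b) ([]-homo-* a c) ⟨
    ([ a ] ⊗ [ b ]) ⊕ ([ a ] ⊗ [ c ])    ∎
    where open ≡-Reasoning

  ⊗-distribʳ-⊕ : ∀ x y z → (y ⊕ z) ⊗ x ≡ (y ⊗ x) ⊕ (z ⊗ x)
  ⊗-distribʳ-⊕ x y z = begin
    (y ⊕ z) ⊗ x          ≡⟨ ⊗-comm (y ⊕ z) x ⟩
    x ⊗ (y ⊕ z)          ≡⟨ ⊗-distribˡ-⊕ x y z ⟩
    (x ⊗ y) ⊕ (x ⊗ z)    ≡⟨ cong₂ _⊕_ (⊗-comm x y) (⊗-comm x z) ⟩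
    (y ⊗ x) ⊕ (z ⊗ x)    ∎
    where open ≡-Reasoning

  ⊕-identityˡ : ∀ x → [ 0 ] ⊕ x ≡ x
  ⊕-identityˡ = []-elim _ ([]-homo-+ 0)

  ⊕-identityʳ : ∀ x → x ⊕ [ 0 ] ≡ x
  ⊕-identityʳ x = trans (⊕-comm x [ 0 ]) (⊕-identityˡ x)

  ⊗-identityˡ : ∀ x → [ 1 ] ⊗ x ≡ x
  ⊗-identityˡ = []-elim _ λ a → trans ([]-homo-* 1 a) (cong [_] (ℕ.*-identityˡ a))

  ⊗-identityʳ : ∀ x → x ⊗ [ 1 ] ≡ x
  ⊗-identityʳ x = trans (⊗-comm x [ 1 ]) (⊗-identityˡ x)

  ⊖-inverseʳ : ∀ x → x ⊕ (⊖ x) ≡ [ 0 ]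
  ⊖-inverseʳ x = begin
    x ⊕ (⊖ x)                     ≡⟨ cong (_⊕ (⊖ x)) ([]-toℕ x) ⟨
    [ toℕ x ] ⊕ [ p ∸ toℕ x ]     ≡⟨ []-homo-+ (toℕ x) (p ∸ toℕ x) ⟩
    [ toℕ x + (p ∸ toℕ x) ]       ≡⟨ cong [_] (ℕ.m+[n∸m]≡n (ℕ.<⇒≤ (Fin.toℕ<n x))) ⟩
    [ p ]                         ≡⟨ %≡⇒[]≡ (trans (n%n≡0 p) (sym 0%p≡0)) ⟩
    [ 0 ]                         ∎
    where open ≡-Reasoning

  p∣⇒[]≡[0] : ∀ {a} → p ∣ a → [ a ] ≡ [ 0 ]
  p∣⇒[]≡[0] p∣a = %≡⇒[]≡ (trans (n∣m⇒m%n≡0 _ p p∣a) (sym 0%p≡0))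

  []≡[0]⇒p∣ : ∀ {a} → [ a ] ≡ [ 0 ] → p ∣ a
  []≡[0]⇒p∣ {a} eq =
    m%n≡0⇒n∣m a p (trans (sym (toℕ-[] a)) (trans (cong toℕ eq) (trans (toℕ-[] 0) 0%p≡0)))

  pow-+ : ∀ g a b → pow g (a + b) ≡ pow g a ⊗ pow g b
  pow-+ g a b = trans (cong [_] (ℕ.^-distribˡ-+-* g a b)) (sym ([]-homo-* (g ^ a) (g ^ b)))

  ⊖-inverseˡ : ∀ x → (⊖ x) ⊕ x ≡ [ 0 ]
  ⊖-inverseˡ x = trans (⊕-comm (⊖ x) x) (⊖-inverseʳ x)

  isCommutativeRing : IsCommutativeRing _≡_ _⊕_ _⊗_ ⊖_ [ 0 ] [ 1 ]
  isCommutativeRing = record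
    { isRing = record
      { +-isAbelianGroup = record
        { isGroup = record
          { isMonoid = record
            { isSemigroup = record
              { isMagma = record { isEquivalence = isEquivalence ; ∙-cong = cong₂ _⊕_ }
              ; assoc = ⊕-assoc }
            ; identity = ⊕-identityˡ , ⊕-identityʳ }
          ; inverse = ⊖-inverseˡ , ⊖-inverseʳ
          ; ⁻¹-cong = cong ⊖_ }
        ; comm = ⊕-comm }
      ; *-cong = cong₂ _⊗_
      ; *-assoc = ⊗-assoc
      ; *-identity = ⊗-identityˡ , ⊗-identityʳ
      ; distrib = ⊗-distribˡ-⊕ , ⊗-distribʳ-⊕ }
    ; *-comm = ⊗-comm }

  commutativeRing : CommutativeRing 0ℓ 0ℓ
  commutativeRing = record { isCommutativeRing = isCommutativeRing }

  open import Algebra.Properties.Ring (CommutativeRing.ring commutativeRing) public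
    using (-‿distribʳ-*; x[y-z]≈xy-xz)
  open import Algebra.Properties.Group (CommutativeRing.+-group commutativeRing) public
    using (inverseˡ-unique; x≈z//y; ⁻¹-involutive; x∙y⁻¹≈ε⇒x≈y; x≈y⇒x∙y⁻¹≈ε)

module PrimeField {p : ℕ} (p-prime : Prime p) where
  private instance
    p≢0 : NonZero p
    p≢0 = prime⇒nonZero p-prime
  open ZMod p
  open ModularArithmetic p

  ⊗-zero-product : ∀ x y → x ⊗ y ≡ [ 0 ] → x ≡ [ 0 ] ⊎ y ≡ [ 0 ]
  ⊗-zero-product x y xy≡0 =
    Sum.map p∣toℕ⇒≡0 p∣toℕ⇒≡0 (euclidsLemma (toℕ x) (toℕ y) p-prime ([]≡[0]⇒p∣ xy≡0))
    where
      p∣toℕ⇒≡0 : ∀ {z} → p ∣ toℕ z → z ≡ [ 0 ]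
      p∣toℕ⇒≡0 {z} p∣z = trans (sym ([]-toℕ z)) (p∣⇒[]≡[0] p∣z)

  [1]≢[0] : [ 1 ] ≢ [ 0 ]
  [1]≢[0] 1≡0 = nonTrivial⇒≢1 {{prime⇒nonTrivial p-prime}} (∣1⇒≡1 ([]≡[0]⇒p∣ 1≡0))

  ⊗-cancelˡ : ∀ x {y z} → x ≢ [ 0 ] → x ⊗ y ≡ x ⊗ z → y ≡ z
  ⊗-cancelˡ x {y} {z} x≢0 xy≡xz with ⊗-zero-product x (y ⊝ z) x[y-z]≡0
    where
      x[y-z]≡0 : x ⊗ (y ⊝ z) ≡ [ 0 ]
      x[y-z]≡0 = trans (x[y-z]≈xy-xz x y z) (x≈y⇒x∙y⁻¹≈ε xy≡xz)
  ... | inj₁ x≡0   = contradiction x≡0 x≢0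
  ... | inj₂ y-z≡0 = x∙y⁻¹≈ε⇒x≈y y z y-z≡0

  square≡1⇒≡±1 : ∀ x → x ⊗ x ≡ [ 1 ] → x ≡ [ 1 ] ⊎ x ≡ ⊖ [ 1 ]
  square≡1⇒≡±1 x x²≡1 with (x ⊕ [ 1 ]) Fin.≟ [ 0 ]
  ... | yes x+1≡0 = inj₂ (inverseˡ-unique x [ 1 ] x+1≡0)
  ... | no x+1≢0  = inj₁ (⊗-cancelˡ (x ⊕ [ 1 ]) x+1≢0 (begin
    (x ⊕ [ 1 ]) ⊗ x            ≡⟨ ⊗-distribʳ-⊕ x x [ 1 ] ⟩
    (x ⊗ x) ⊕ ([ 1 ] ⊗ x)      ≡⟨ cong₂ _⊕_ x²≡1 (⊗-identityˡ x) ⟩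
    [ 1 ] ⊕ x                  ≡⟨ ⊕-comm [ 1 ] x ⟩
    x ⊕ [ 1 ]                  ≡⟨ ⊗-identityʳ (x ⊕ [ 1 ]) ⟨
    (x ⊕ [ 1 ]) ⊗ [ 1 ]        ∎))
    where open ≡-Reasoning

module PrimitiveRoot {n : ℕ} (p-prime : Prime (suc n)) {g : ℕ} (g-primitive : ZMod.IsPrimitiveRoot (suc n) g) where
  open ZMod (suc n)
  open ModularArithmetic (suc n)
  open PrimeField p-prime

  instance
    n≢0 : NonZero n
    n≢0 = >-nonZero (s<s⁻¹ (nonTrivial⇒n>1 (suc n) {{prime⇒nonTrivial p-prime}}))

  g≢0 : [ g ] ≢ [ 0 ]
  g≢0 = proj₁ g-primitive

  gⁿ≡1 : pow g n ≡ [ 1 ]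
  gⁿ≡1 = proj₁ (proj₂ g-primitive)

  order : ∀ e → 0 < e → e < n → pow g e ≢ [ 1 ]
  order = proj₂ (proj₂ g-primitive)

  pow-≢0 : ∀ e → pow g e ≢ [ 0 ]
  pow-≢0 zero    = [1]≢[0]
  pow-≢0 (suc e) gᵉ⁺¹≡0 with ⊗-zero-product [ g ] (pow g e) (trans ([]-homo-* g (g ^ e)) gᵉ⁺¹≡0)
  ... | inj₁ g≡0  = g≢0 g≡0
  ... | inj₂ gᵉ≡0 = pow-≢0 e gᵉ≡0

  pow-+-*n : ∀ e q → pow g (e + q * n) ≡ pow g e
  pow-+-*n e zero    = cong (pow g) (ℕ.+-identityʳ e)
  pow-+-*n e (suc q) = begin
    pow g (e + (n + q * n))        ≡⟨ cong (pow g) (x∙yz≈y∙xz e n (q * n)) ⟩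
    pow g (n + (e + q * n))        ≡⟨ pow-+ g n (e + q * n) ⟩
    pow g n ⊗ pow g (e + q * n)    ≡⟨ cong₂ _⊗_ gⁿ≡1 (pow-+-*n e q) ⟩
    [ 1 ] ⊗ pow g e                ≡⟨ ⊗-identityˡ (pow g e) ⟩
    pow g e                        ∎
    where open ≡-Reasoning

  pow-%n : ∀ e → pow g (e % n) ≡ pow g e
  pow-%n e = trans (sym (pow-+-*n (e % n) (e / n))) (cong (pow g) (sym (m≡m%n+[m/n]*n e n)))

  pow-distinct : ∀ {a b} → a < b → b < n → pow g a ≢ pow g b
  pow-distinct {a} {b} a<b b<n gᵃ≡gᵇ =
    order (b ∸ a) (ℕ.m<n⇒0<n∸m a<b) (ℕ.≤-<-trans (ℕ.m∸n≤m b a) b<n)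
    (⊗-cancelˡ (pow g a) (pow-≢0 a) (begin
      pow g a ⊗ pow g (b ∸ a)    ≡⟨ pow-+ g a (b ∸ a) ⟨
      pow g (a + (b ∸ a))        ≡⟨ cong (pow g) (ℕ.m+[n∸m]≡n (ℕ.<⇒≤ a<b)) ⟩
      pow g b                    ≡⟨ gᵃ≡gᵇ ⟨
      pow g a                    ≡⟨ ⊗-identityʳ (pow g a) ⟨
      pow g a ⊗ [ 1 ]            ∎))
    where open ≡-Reasoning

  pow-injective-%n : ∀ {a b} → pow g a ≡ pow g b → a % n ≡ b % n
  pow-injective-%n {a} {b} gᵃ≡gᵇ = ℕ.≤-antisym (ℕ.≮⇒≥ λ b<a → pow-distinct b<a (m%n<n a n) (sym reduced))
                                              (ℕ.≮⇒≥ λ a<b → pow-distinct a<b (m%n<n b n) reduced)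
    where
      reduced : pow g (a % n) ≡ pow g (b % n)
      reduced = trans (pow-%n a) (trans gᵃ≡gᵇ (sym (pow-%n b)))

  private
    index : ∀ {x} → x ≢ [ 0 ] → Fin n
    index x≢0 = punchOut {i = zero} (x≢0 ∘ sym)

    index-injective : ∀ {x y} (x≢0 : x ≢ [ 0 ]) (y≢0 : y ≢ [ 0 ]) → index x≢0 ≡ index y≢0 → x ≡ y
    index-injective x≢0 y≢0 = Fin.punchOut-injective (x≢0 ∘ sym) (y≢0 ∘ sym)

  -- x, g⁰, …, gⁿ⁻¹ are n + 1 nonzero residues, so two of them coincide; the powers are distinct.
  pow-surjective : ∀ {x} → x ≢ [ 0 ] → ∃[ e ] pow g e ≡ x
  pow-surjective {x} x≢0 with Fin.pigeonhole (ℕ.n<1+n n) (λ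
      { zero    → index x≢0
      ; (suc t) → index (pow-≢0 (toℕ t)) })
  ... | zero  , suc t , _   , eq = toℕ t , sym (index-injective x≢0 (pow-≢0 (toℕ t)) eq)
  ... | suc s , suc t , s<t , eq = contradiction (index-injective (pow-≢0 (toℕ s)) (pow-≢0 (toℕ t)) eq)
                                                 (pow-distinct (s<s⁻¹ s<t) (Fin.toℕ<n t))

  pow-half : ∀ h → h + h ≡ n → pow g h ≡ ⊖ [ 1 ]
  pow-half h h+h≡n with square≡1⇒≡±1 (pow g h) (trans (sym (pow-+ g h h)) (trans (cong (pow g) h+h≡n) gⁿ≡1))
  ... | inj₂ gʰ≡-1 = gʰ≡-1
  ... | inj₁ gʰ≡1  = contradiction gʰ≡1 (order h 0<h (subst (h <_) h+h≡n (ℕ.m<m+n h 0<h)))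
    where
      0<h : 0 < h
      0<h = ℕ.n≢0⇒n>0 λ h≡0 → ≢-nonZero⁻¹ n (trans (sym h+h≡n) (cong (λ u → u + u) h≡0))

module CongruenceModulo (m : ℕ) .{{_ : NonZero m}} where

  infix 4 _≡ₘ_
  _≡ₘ_ : ℕ → ℕ → Set
  a ≡ₘ b = a % m ≡ b % m

  ≡ₘ-+ : ∀ {a a′ b b′} → a ≡ₘ a′ → b ≡ₘ b′ → a + b ≡ₘ a′ + b′
  ≡ₘ-+ {a} {a′} {b} {b′} a≡a′ b≡b′ = begin
    (a + b) % m              ≡⟨ %-distribˡ-+ a b m ⟩
    (a % m + b % m) % m      ≡⟨ cong₂ (λ u v → (u + v) % m) a≡a′ b≡b′ ⟩
    (a′ % m + b′ % m) % m    ≡⟨ %-distribˡ-+ a′ b′ m ⟨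
    (a′ + b′) % m            ∎
    where open ≡-Reasoning

  ∣⇒≡ₘ0 : ∀ {a} → m ∣ a → a ≡ₘ 0
  ∣⇒≡ₘ0 {a} m∣a = trans (n∣m⇒m%n≡0 a m m∣a) (sym (m<n⇒m%n≡m (>-nonZero⁻¹ m)))

  <-≡ₘ⇒≡ : ∀ {a b} → a < m → b < m → a ≡ₘ b → a ≡ b
  <-≡ₘ⇒≡ a<m b<m a≡b = trans (sym (m<n⇒m%n≡m a<m)) (trans a≡b (m<n⇒m%n≡m b<m))

  infixl 6 _-ₘ_
  _-ₘ_ : ℕ → ℕ → ℕ
  a -ₘ b = (a + (m ∸ b % m)) % m

  -ₘ<m : ∀ a b → a -ₘ b < m
  -ₘ<m a b = m%n<n (a + (m ∸ b % m)) m

  [a-ₘb]+b≡ₘa : ∀ a b → (a -ₘ b) + b ≡ₘ a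
  [a-ₘb]+b≡ₘa a b = begin
    ((a + (m ∸ b % m)) % m + b) % m     ≡⟨ ≡ₘ-+ (m%n%n≡m%n (a + (m ∸ b % m)) m) (sym (m%n%n≡m%n b m)) ⟩
    (a + (m ∸ b % m) + b % m) % m       ≡⟨ cong (_% m) (ℕ.+-assoc a (m ∸ b % m) (b % m)) ⟩
    (a + (m ∸ b % m + b % m)) % m       ≡⟨ cong (λ u → (a + u) % m) (ℕ.m∸n+n≡m (m%n≤n b m)) ⟩
    (a + m) % m                         ≡⟨ [m+n]%n≡m%n a m ⟩
    a % m                               ∎
    where open ≡-Reasoning

module Cosets (m k : ℕ) .{{_ : NonZero m}} (p-prime : Prime (suc (m * k))) {g : ℕ}
              (g-primitive : ZMod.IsPrimitiveRoot (suc (m * k)) g) where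
  open ZMod (suc (m * k))
  open ModularArithmetic (suc (m * k))
  open PrimeField p-prime
  open PrimitiveRoot p-prime g-primitive
  open CongruenceModulo m

  n : ℕ
  n = m * k

  m∣n : m ∣ n
  m∣n = divides k (ℕ.*-comm m k)

  -- Coset c is X_(c mod m); indexing by all of ℕ keeps the index arithmetic in ℕ.
  Coset : ℕ → Subset
  Coset c x = ∃[ e ] (e ≡ₘ c × x ≡ pow g e)

  Coset-pow : ∀ e → Coset e (pow g e)
  Coset-pow e = e , refl , refl

  Coset-cong : ∀ {a b x} → a ≡ₘ b → Coset a x → Coset b x
  Coset-cong a≡b (e , e≡a , x≡gᵉ) = e , trans e≡a a≡b , x≡gᵉ

  Coset-⊗ : ∀ {a b x y} → Coset a x → Coset b y → Coset (a + b) (x ⊗ y)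
  Coset-⊗ (d , d≡a , x≡gᵈ) (e , e≡b , y≡gᵉ) =
    d + e , ≡ₘ-+ d≡a e≡b , trans (cong₂ _⊗_ x≡gᵈ y≡gᵉ) (sym (pow-+ g d e))

  Coset-≢0 : ∀ {a x} → Coset a x → x ≢ [ 0 ]
  Coset-≢0 (e , _ , x≡gᵉ) x≡0 = pow-≢0 e (trans (sym x≡gᵉ) x≡0)

  ≢0⇒Coset : ∀ {x} → x ≢ [ 0 ] → ∃[ e ] Coset e x
  ≢0⇒Coset x≢0 with e , gᵉ≡x ← pow-surjective x≢0 = e , e , refl , sym gᵉ≡x

  Coset-unique : ∀ {a b x} → Coset a x → Coset b x → a ≡ₘ b
  Coset-unique (d , d≡a , x≡gᵈ) (e , e≡b , x≡gᵉ) = begin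
    _ % m          ≡⟨ d≡a ⟨
    d % m          ≡⟨ m∣n⇒o%n%m≡o%m m n d m∣n ⟨
    d % n % m      ≡⟨ cong (_% m) (pow-injective-%n (trans (sym x≡gᵈ) x≡gᵉ)) ⟩
    e % n % m      ≡⟨ m∣n⇒o%n%m≡o%m m n e m∣n ⟩
    e % m          ≡⟨ e≡b ⟩
    _ % m          ∎
    where open ≡-Reasoning

  Coset-div : ∀ {b c x z} → Coset (b + c) x → Coset b z → ∃[ v ] (Coset c v × x ≡ z ⊗ v)
  Coset-div {b} {c} {x} {z} (d , d≡b+c , x≡gᵈ) (e , e≡b , z≡gᵉ) =
    pow g (d + e⁻¹) , (d + e⁻¹ , class , refl) , (begin
      x                        ≡⟨ x≡gᵈ ⟩
      pow g d                  ≡⟨ pow-+-*n d e ⟨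
      pow g (d + e * n)        ≡⟨ cong (λ u → pow g (d + u)) e+e⁻¹≡e*n ⟨
      pow g (d + (e + e⁻¹))    ≡⟨ cong (pow g) (x∙yz≈y∙xz d e e⁻¹) ⟩
      pow g (e + (d + e⁻¹))    ≡⟨ pow-+ g e (d + e⁻¹) ⟩
      pow g e ⊗ pow g (d + e⁻¹) ≡⟨ cong (_⊗ pow g (d + e⁻¹)) z≡gᵉ ⟨
      z ⊗ pow g (d + e⁻¹)      ∎)
    where
      open ≡-Reasoning
      e⁻¹ : ℕ
      e⁻¹ = e * pred n
      e+e⁻¹≡e*n : e + e⁻¹ ≡ e * n
      e+e⁻¹≡e*n = trans (sym (ℕ.*-suc e (pred n))) (cong (e *_) (ℕ.suc-pred n))
      class : d + e⁻¹ ≡ₘ c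
      class = begin
        (d + e⁻¹) % m          ≡⟨ ≡ₘ-+ (trans d≡b+c (≡ₘ-+ (sym e≡b) refl)) refl ⟩
        (e + c + e⁻¹) % m      ≡⟨ cong (_% m) (xy∙z≈y∙xz e c e⁻¹) ⟩
        (c + (e + e⁻¹)) % m    ≡⟨ ≡ₘ-+ {c} refl (subst (_≡ₘ 0) (sym e+e⁻¹≡e*n) (∣⇒≡ₘ0 (∣n⇒∣m*n e m∣n))) ⟩
        (c + 0) % m            ≡⟨ cong (_% m) (ℕ.+-identityʳ c) ⟩
        c % m                  ∎

  Coset-ratio : ∀ {a x z} → Coset a x → Coset a z → ∃[ v ] (Coset 0 v × x ≡ z ⊗ v)
  Coset-ratio {a} x∈Cₐ = Coset-div (Coset-cong (cong (_% m) (sym (ℕ.+-identityʳ a))) x∈Cₐ)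

  X⇒Coset : ∀ {i x} → X g m k i x → Coset i x
  X⇒Coset {i} (t , _ , x≡gᵉ) = t * m + i , [tm+i]≡ₘi , x≡gᵉ
    where
      [tm+i]≡ₘi : t * m + i ≡ₘ i
      [tm+i]≡ₘi = trans (cong (_% m) (ℕ.+-comm (t * m) i)) ([m+kn]%n≡m%n i t m)

  Coset⇒X : ∀ {i x} → i < m → Coset i x → X g m k i x
  Coset⇒X {i} {x} i<m (e , e≡i , x≡gᵉ) = t , t<k , (begin
    x                       ≡⟨ x≡gᵉ ⟩
    pow g e                 ≡⟨ pow-%n e ⟨
    pow g r                 ≡⟨ cong (pow g) (m≡m%n+[m/n]*n r m) ⟩
    pow g (r % m + t * m)   ≡⟨ cong (λ u → pow g (u + t * m)) r%m≡i ⟩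
    pow g (i + t * m)       ≡⟨ cong (pow g) (ℕ.+-comm i (t * m)) ⟩
    pow g (t * m + i)       ∎)
    where
      open ≡-Reasoning
      r t : ℕ
      r = e % n
      t = r / m
      t<k : t < k
      t<k = m<n*o⇒m/o<n (subst (r <_) (ℕ.*-comm m k) (m%n<n e n))
      r%m≡i : r % m ≡ i
      r%m≡i = trans (m∣n⇒o%n%m≡o%m m n e m∣n) (trans e≡i (m<n⇒m%n≡m i<m))

  sumset-Coset⇒X : ∀ {a b i j x} → i < m → j < m → a ≡ₘ i → b ≡ₘ j →
                   sumset (Coset a) (Coset b) x → sumset (X g m k i) (X g m k j) x
  sumset-Coset⇒X i<m j<m a≡i b≡j (y , z , y∈Cₐ , z∈C_b , x≡y+z) =
    y , z , Coset⇒X i<m (Coset-cong a≡i y∈Cₐ) , Coset⇒X j<m (Coset-cong b≡j z∈C_b) , x≡y+z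

  module _ (k-even : 2 ∣ k) where

    -1∈Coset0 : Coset 0 (⊖ [ 1 ])
    -1∈Coset0 = q * m , ∣⇒≡ₘ0 (n∣m*n q) , sym (pow-half (q * m) qm+qm≡n)
      where
        open _∣_ k-even renaming (quotient to q; equality to k≡q*2)
        qm+qm≡n : q * m + q * m ≡ n
        qm+qm≡n = trans (solve 2 (λ q m → q :* m :+ q :* m := m :* (q :* con 2)) refl q m) (cong (m *_) (sym k≡q*2))
          where open +-*-Solver

    Coset-⊖ : ∀ {a x} → Coset a x → Coset a (⊖ x)
    Coset-⊖ {a} {x} x∈Cₐ = subst₂ Coset (ℕ.+-identityʳ a) x·-1≡-x (Coset-⊗ x∈Cₐ -1∈Coset0)
      where
        x·-1≡-x : x ⊗ (⊖ [ 1 ]) ≡ ⊖ x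
        x·-1≡-x = trans (sym (-‿distribʳ-* x [ 1 ])) (cong ⊖_ (⊗-identityʳ x))

    Coset-decompose : ∀ {a b c h s x} → Coset 0 h → Coset b s → Coset a (h ⊝ s) → Coset (a + c) x →
                      sumset (Coset c) (Coset (b + c)) x
    Coset-decompose {h = h} {s} h∈C₀ s∈C_b [h-s]∈Cₐ x∈C
      with w , w∈C_c , x≡[h-s]w ← Coset-div x∈C [h-s]∈Cₐ =
      h ⊗ w , (⊖ s) ⊗ w , Coset-⊗ h∈C₀ w∈C_c , Coset-⊗ (Coset-⊖ s∈C_b) w∈C_c ,
      trans x≡[h-s]w (⊗-distribʳ-⊕ w h (⊖ s))

    X-neg : ∀ i → i < m → neg (X g m k i) ≐ X g m k i
    X-neg i i<m x =
        (λ { (a , a∈Xᵢ , x≡-a) → Coset⇒X i<m (subst (Coset i) (sym x≡-a) (Coset-⊖ (X⇒Coset a∈Xᵢ))) })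
      , λ x∈Xᵢ → ⊖ x , Coset⇒X i<m (Coset-⊖ (X⇒Coset x∈Xᵢ)) , sym (⁻¹-involutive x)

    module _ (disjoint : Disjoint (shift (X g m k 0) [ 1 ]) (X g m k 0))
             (meets : ∀ i j → i < m → j < m → ¬ (i ≡ 0 × j ≡ 0) →
                      Meets (shift (X g m k 0) (pow g j)) (X g m k i)) where

      0<m : 0 < m
      0<m = >-nonZero⁻¹ m

      Coset-sum-free : ∀ {i a b} → Coset i a → Coset i b → ¬ Coset i (a ⊕ b)
      Coset-sum-free {i} {a} {b} a∈Cᵢ b∈Cᵢ a+b∈Cᵢ
        with v , v∈C₀ , a≡bv ← Coset-ratio a∈Cᵢ b∈Cᵢ
           | w , w∈C₀ , a+b≡bw ← Coset-ratio a+b∈Cᵢ b∈Cᵢ =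
        disjoint v ((w , Coset⇒X 0<m w∈C₀ , x≈z//y v [ 1 ] w (sym w≡v+1)) , Coset⇒X 0<m v∈C₀)
        where
          open ≡-Reasoning
          w≡v+1 : w ≡ v ⊕ [ 1 ]
          w≡v+1 = ⊗-cancelˡ b (Coset-≢0 b∈Cᵢ) (begin
            b ⊗ w                    ≡⟨ a+b≡bw ⟨
            a ⊕ b                    ≡⟨ cong₂ _⊕_ a≡bv (sym (⊗-identityʳ b)) ⟩
            (b ⊗ v) ⊕ (b ⊗ [ 1 ])    ≡⟨ ⊗-distribˡ-⊕ b v [ 1 ] ⟨
            b ⊗ (v ⊕ [ 1 ])          ∎)

      X-sumset-cover : ∀ {i j e x} → i < m → j < m → Coset e x → ¬ (e -ₘ i ≡ 0 × j -ₘ i ≡ 0) →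
                       sumset (X g m k i) (X g m k j) x
      X-sumset-cover {i} {j} {e} i<m j<m x∈Cₑ not-both-0
        with z , (h , h∈X₀ , z≡h-s) , z∈Xₐ ← meets (e -ₘ i) (j -ₘ i) (-ₘ<m e i) (-ₘ<m j i) not-both-0 =
        sumset-Coset⇒X i<m j<m refl ([a-ₘb]+b≡ₘa j i)
          (Coset-decompose (X⇒Coset h∈X₀) (Coset-pow (j -ₘ i))
            (subst (Coset (e -ₘ i)) z≡h-s (X⇒Coset z∈Xₐ)) (Coset-cong (sym ([a-ₘb]+b≡ₘa e i)) x∈Cₑ))

      X-sumset-self : ∀ i → i < m → sumset (X g m k i) (X g m k i) ≐ (λ x → ¬ X g m k i x)
      X-sumset-self i i<m x = sum-free , cover
        where
          sum-free : sumset (X g m k i) (X g m k i) x → ¬ X g m k i x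
          sum-free (a , b , a∈Xᵢ , b∈Xᵢ , x≡a+b) x∈Xᵢ =
            Coset-sum-free (X⇒Coset a∈Xᵢ) (X⇒Coset b∈Xᵢ) (subst (Coset i) x≡a+b (X⇒Coset x∈Xᵢ))
          cover : ¬ X g m k i x → sumset (X g m k i) (X g m k i) x
          cover x∉Xᵢ with x Fin.≟ [ 0 ]
          ... | yes x≡0 = pow g i , ⊖ pow g i , Coset⇒X i<m (Coset-pow i) , Coset⇒X i<m (Coset-⊖ (Coset-pow i)) ,
                          trans x≡0 (sym (⊖-inverseʳ (pow g i)))
          ... | no x≢0 with e , x∈Cₑ ← ≢0⇒Coset x≢0 | (e -ₘ i) ℕ.≟ 0
          ... | yes c≡0 = contradiction (Coset⇒X i<m x∈Cᵢ) x∉Xᵢ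
            where
              x∈Cᵢ : Coset (0 + i) x
              x∈Cᵢ = subst (λ c → Coset (c + i) x) c≡0 (Coset-cong (sym ([a-ₘb]+b≡ₘa e i)) x∈Cₑ)
          ... | no c≢0  = X-sumset-cover i<m i<m x∈Cₑ (c≢0 ∘ proj₁)

      X-sumset-distinct : ∀ i j → i < m → j < m → i ≢ j →
                          sumset (X g m k i) (X g m k j) ≐ (λ x → x ≢ [ 0 ])
      X-sumset-distinct i j i<m j<m i≢j x = nonzero , cover
        where
          nonzero : sumset (X g m k i) (X g m k j) x → x ≢ [ 0 ]
          nonzero (a , b , a∈Xᵢ , b∈Xⱼ , x≡a+b) x≡0 =
            i≢j (<-≡ₘ⇒≡ i<m j<m (Coset-unique (X⇒Coset a∈Xᵢ) a∈Cⱼ))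
            where
              a≡-b : a ≡ ⊖ b
              a≡-b = inverseˡ-unique a b (trans (sym x≡a+b) x≡0)
              a∈Cⱼ : Coset j a
              a∈Cⱼ = subst (Coset j) (sym a≡-b) (Coset-⊖ (X⇒Coset b∈Xⱼ))
          cover : x ≢ [ 0 ] → sumset (X g m k i) (X g m k j) x
          cover x≢0 with e , x∈Cₑ ← ≢0⇒Coset x≢0 = X-sumset-cover i<m j<m x∈Cₑ (j≢i ∘ proj₂)
            where
              j≢i : j -ₘ i ≢ 0
              j≢i j-i≡0 = i≢j (sym (<-≡ₘ⇒≡ j<m i<m
                (trans (sym ([a-ₘb]+b≡ₘa j i)) (cong (λ c → (c + i) % m) j-i≡0))))

      ramseyAlgebra : RamseyAlgebra m (X g m k)
      ramseyAlgebra = X-neg , X-sumset-self , X-sumset-distinct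

corollary3 : (m k g : ℕ) → 1 ≤ m → Prime (suc (m * k)) → 2 ∣ k →
    let open ZMod (suc (m * k)) in
    IsPrimitiveRoot g →
    Disjoint (shift (X g m k 0) [ 1 ]) (X g m k 0) →
    (∀ i j → i < m → j < m → ¬ (i ≡ 0 × j ≡ 0) →
      Meets (shift (X g m k 0) (pow g j)) (X g m k i)) →
    RamseyAlgebra m (X g m k)
corollary3 m k g 1≤m p-prime k-even g-primitive =
  Cosets.ramseyAlgebra m k {{>-nonZero 1≤m}} p-prime g-primitive k-even
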